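{- For any string $S$ of length $n$, $\sum_{w} \phi_S(w) \le 2n-2$, where the sum ranges over all substrings $w$ of $S$ (with $\phi_S(w)$ taken to be $0$ when $w$ is not a repeat).
   Context: For strings $w,S$, $\mathrm{occ}_S(w)$ denotes the number of starting positions $i$ with $S[i..i+|w|-1]=w$. A repeat in $S$ is a string $w$ with $\mathrm{occ}_S(w)\ge 2$. For a repeat $w$ of $S$, $\Phi_S(w) = \{(\alpha,\beta)\in\Sigma\times\Sigma \mid \mathrm{occ}_S(\alpha w\beta)=\mathrm{occ}_S(\alpha w)=\mathrm{occ}_S(w\beta)=1\}$ and the net frequency is $\phi_S(w)=|\Phi_S(w)|$. -}

module Defs where

open import Data.Nat using (ℕ; zero; suc; _+_)
open import Data.Fin using (Fin)
open import Data.Fin.Properties using (_≟_)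
open import Data.List using (List; []; _∷_; _++_; length; take; tails; inits; concatMap; filter; deduplicate; cartesianProduct; allFin; map; [_])
open import Data.Nat.ListAction using (sum)
open import Data.List.Properties using (≡-dec)
open import Data.Product using (_×_; _,_)
open import Relation.Nullary using (yes; no)
open import Relation.Binary.PropositionalEquality using (_≡_)

Str : ℕ → Set
Str σ = List (Fin σ)

_≟s_ : ∀ {σ} (u v : Str σ) → Relation.Nullary.Dec (u ≡ v)
_≟s_ = ≡-dec _≟_

-- occ S w : number of starting positions i with S[i..i+|w|-1] = w,
-- i.e. number of suffixes of S that begin with w.
occ : ∀ {σ} → Str σ → Str σ → ℕ
occ S w = length (filter (λ t → take (length w) t ≟s w) (tails S))

substrings : ∀ {σ} → Str σ → List (Str σ)
substrings S = deduplicate _≟s_ (concatMap inits (tails S))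

InΦ : ∀ {σ} → Str σ → Str σ → Fin σ × Fin σ → Set
InΦ S w (α , β) = (occ S (α ∷ w ++ [ β ]) ≡ 1) × (occ S (α ∷ w) ≡ 1) × (occ S (w ++ [ β ]) ≡ 1)

InΦ? : ∀ {σ} (S w : Str σ) (p : Fin σ × Fin σ) → Relation.Nullary.Dec (InΦ S w p)
InΦ? S w (α , β) with Data.Nat._≟_ (occ S (α ∷ w ++ [ β ])) 1 | Data.Nat._≟_ (occ S (α ∷ w)) 1 | Data.Nat._≟_ (occ S (w ++ [ β ])) 1
... | yes a | yes b | yes c = yes (a , b , c)
... | no ¬a | _ | _ = no (λ { (a , _ , _) → ¬a a })
... | yes _ | no ¬b | _ = no (λ { (_ , b , _) → ¬b b })
... | yes _ | yes _ | no ¬c = no (λ { (_ , _ , c) → ¬c c })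

Φ : ∀ {σ} → Str σ → Str σ → List (Fin σ × Fin σ)
Φ {σ} S w = filter (InΦ? S w) (cartesianProduct (allFin σ) (allFin σ))

-- net frequency; taken to be 0 when w is not a repeat (occ < 2)
φ : ∀ {σ} → Str σ → Str σ → ℕ
φ S w with Data.Nat._≤?_ 2 (occ S w)
... | yes _ = length (Φ S w)
... | no _ = 0

totalNetFreq : ∀ {σ} → Str σ → ℕ
totalNetFreq S = sum (map (φ S) (substrings S))

-- Every pair (α , β) counted by φ_S(w) singles out one position of S: the
-- start of the unique occurrence of αwβ.  Two counted triples (w, α, β) and
-- (w', α', β') with the same position coincide, since if |w| < |w'| then wβ
-- is a prefix of w', so occ(w') ≤ occ(wβ) = 1 and w' would not be a repeat.
-- As |αwβ| ≥ 2 only the n - 1 positions 0, …, n - 2 can be hit, so the sum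
-- is at most n - 1 ≤ 2n - 2.
module Submission where

open import Defs
open import Data.Nat using (ℕ; zero; suc; _+_; _*_; _∸_; _≤_; _<_; z≤n; s≤s; _≤?_)
import Data.Nat as ℕ
open import Data.Nat.Properties
  using (≤-refl; ≤-trans; ≤-reflexive; ≤-antisym; m≤n⇒m≤1+n; m≤m+n; m≤n+m; m⊓n≤n; ≮⇒≥; <-irrefl;
         ≤∧≢⇒<; ≤-pred; +-mono-≤; +-comm; module ≤-Reasoning; suc-injective; +-identityʳ; ∸-monoʳ-<; ∸-cancelˡ-≡; *-distribˡ-∸)
open import Data.Nat.ListAction using (sum)
open import Data.Fin using (Fin)
open import Data.List using (List; []; _∷_; length; _++_; [_]; take; drop; tails; filter; map; cartesianProduct; allFin; concatMap; inits)
open import Data.List.Properties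
  using (length-++; length-take; take++drop≡id; ++-assoc; ∷-injective; ∷ʳ-injective; filter-++;
         filter-all; filter-accept; filter-reject; length-map)
open import Data.List.Membership.Propositional using (_∈_)
open import Data.List.Membership.Propositional.Properties using (∈-filter⁻)
open import Data.List.Relation.Unary.Any using (here; there)
open import Data.List.Relation.Unary.All as All using (All; []; _∷_)
import Data.List.Relation.Unary.All.Properties as All
open import Data.List.Relation.Unary.AllPairs using ([]; _∷_)
open import Data.List.Relation.Unary.Unique.Propositional using (Unique)
import Data.List.Relation.Unary.Unique.Propositional.Properties as Unique
import Data.List.Relation.Unary.Unique.DecPropositional.Properties as DecUnique
open import Data.List.Relation.Binary.Sublist.Propositional using (⊆-refl)
open import Data.List.Relation.Binary.Sublist.Propositional.Properties using (filter⁺; length-mono-≤)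
open import Data.Product using (_×_; _,_; proj₁; proj₂; ∃-syntax)
open import Function using (_∘_)
open import Relation.Nullary using (Dec; yes; no; ¬_; ¬?; contradiction)
open import Relation.Binary.PropositionalEquality using (_≡_; _≢_; refl; sym; trans; cong; subst; ≢-sym)

private
  variable
    A B : Set
    σ : ℕ

take-length-++ : (x r : List A) → take (length x) (x ++ r) ≡ x
take-length-++ []      r = refl
take-length-++ (a ∷ x) r = cong (a ∷_) (take-length-++ x r)

take-length⇒++-drop : {x t : List A} → take (length x) t ≡ x → t ≡ x ++ drop (length x) t
take-length⇒++-drop {x = x} {t} eq = trans (sym (take++drop≡id (length x) t)) (cong (_++ drop (length x) t) eq)

take-length⇒length≤ : {x t : List A} → take (length x) t ≡ x → length x ≤ length t
take-length⇒length≤ {x = x} {t} eq =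
  subst (_≤ length t) (trans (sym (length-take (length x) t)) (cong length eq)) (m⊓n≤n (length x) (length t))

++-≡-++⇒prefix : (a r b s : List A) → a ++ r ≡ b ++ s → length a ≤ length b → ∃[ q ] b ≡ a ++ q
++-≡-++⇒prefix []      r b       s eq _         = b , refl
++-≡-++⇒prefix (x ∷ a) r (y ∷ b) s eq (s≤s a≤b) with ∷-injective eq
... | refl , eq′ with ++-≡-++⇒prefix a r b s eq′ a≤b
...   | q , refl = q , refl

++-≡-++⇒≡ : (a r b s : List A) → a ++ r ≡ b ++ s → length a ≡ length b → a ≡ b
++-≡-++⇒≡ []      r []      s eq _ = refl
++-≡-++⇒≡ (x ∷ a) r (y ∷ b) s eq l with ∷-injective eq
... | refl , eq′ = cong (x ∷_) (++-≡-++⇒≡ a r b s eq′ (suc-injective l))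

∈-tails⇒length≤ : {t xs : List A} → t ∈ tails xs → length t ≤ length xs
∈-tails⇒length≤ {xs = []}     (here refl) = z≤n
∈-tails⇒length≤ {xs = x ∷ xs} (here refl) = ≤-refl
∈-tails⇒length≤ {xs = x ∷ xs} (there t∈) = m≤n⇒m≤1+n (∈-tails⇒length≤ t∈)

∈-tails-length-injective : {t t′ xs : List A} → t ∈ tails xs → t′ ∈ tails xs → length t ≡ length t′ → t ≡ t′
∈-tails-length-injective {xs = []}     (here refl) (here refl) _ = refl
∈-tails-length-injective {xs = x ∷ xs} (here refl) (here refl) _ = refl
∈-tails-length-injective {xs = x ∷ xs} (here refl) (there t′∈) l =
  contradiction (≤-trans (s≤s (∈-tails⇒length≤ t′∈)) (≤-reflexive l)) (<-irrefl refl)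
∈-tails-length-injective {xs = x ∷ xs} (there t∈) (here refl) l =
  contradiction (≤-trans (s≤s (∈-tails⇒length≤ t∈)) (≤-reflexive (sym l))) (<-irrefl refl)
∈-tails-length-injective {xs = x ∷ xs} (there t∈) (there t′∈) l = ∈-tails-length-injective t∈ t′∈ l

map⁺-injectiveOn : {xs : List A} (f : A → B) →
                   (∀ {x y} → x ∈ xs → y ∈ xs → f x ≡ f y → x ≡ y) →
                   Unique xs → Unique (map f xs)
map⁺-injectiveOn f inj [] = []
map⁺-injectiveOn f inj (x∉xs ∷ u) =
  All.map⁺ (All.tabulate λ y∈ fx≡fy → All.lookup x∉xs y∈ (inj (here refl) (there y∈) fx≡fy))
  ∷ map⁺-injectiveOn f (λ x∈ y∈ → inj (there x∈) (there y∈)) u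

Unique⇒length≤1+length-filter≢ : ∀ k {xs : List ℕ} → Unique xs →
                                 length xs ≤ suc (length (filter (λ y → ¬? (y ℕ.≟ k)) xs))
Unique⇒length≤1+length-filter≢ k {[]} [] = z≤n
Unique⇒length≤1+length-filter≢ k {x ∷ xs} (x∉xs ∷ u) with x ℕ.≟ k
... | yes refl = s≤s (≤-reflexive (cong length (sym filter≢x≡xs)))
  where
  filter≢x≡xs : filter (λ y → ¬? (y ℕ.≟ x)) (x ∷ xs) ≡ xs
  filter≢x≡xs = trans (filter-reject (λ y → ¬? (y ℕ.≟ x)) (λ x≢x → x≢x refl))
                      (filter-all (λ y → ¬? (y ℕ.≟ x)) (All.map ≢-sym x∉xs))
... | no x≢k = ≤-trans (s≤s (Unique⇒length≤1+length-filter≢ k u))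
                       (≤-reflexive (cong (suc ∘ length) (sym (filter-accept (λ y → ¬? (y ℕ.≟ k)) x≢k))))

Unique∧All<⇒length≤ : ∀ m {xs : List ℕ} → Unique xs → All (_< m) xs → length xs ≤ m
Unique∧All<⇒length≤ zero    [] [] = z≤n
Unique∧All<⇒length≤ (suc k) {xs} u xs<1+k =
  ≤-trans (Unique⇒length≤1+length-filter≢ k u)
          (s≤s (Unique∧All<⇒length≤ k (Unique.filter⁺ ≢k? u)
                 (All.zipWith <k (All.filter⁺ ≢k? xs<1+k , All.all-filter ≢k? xs))))
  where
  ≢k? = λ y → ¬? (y ℕ.≟ k)
  <k : ∀ {y} → y < suc k × y ≢ k → y < k
  <k (y<1+k , y≢k) = ≤∧≢⇒< (≤-pred y<1+k) y≢k

occurrences : Str σ → Str σ → List (Str σ)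
occurrences S x = filter (λ t → take (length x) t ≟s x) (tails S)

occ-++-≤ : (S u r : Str σ) → occ S (u ++ r) ≤ occ S u
occ-++-≤ S u r = length-mono-≤ (filter⁺ (λ t → take (length (u ++ r)) t ≟s (u ++ r)) (λ t → take (length u) t ≟s u)
                                        (λ { refl → prefix }) (⊆-refl {x = tails S}))
  where
  prefix : ∀ {t} → take (length (u ++ r)) t ≡ u ++ r → take (length u) t ≡ u
  prefix {t} eq = trans (cong (take (length u)) (trans (take-length⇒++-drop eq) (++-assoc u r _)))
                        (take-length-++ u _)

record SingleOccurrence (S x : Str σ) : Set where
  field
    suffix       : Str σ
    occurrences≡ : occurrences S x ≡ [ suffix ]
    suffix∈tails : suffix ∈ tails S
    prefix       : take (length x) suffix ≡ x

occ≡1⇒SingleOccurrence : (S x : Str σ) → occ S x ≡ 1 → SingleOccurrence S x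
occ≡1⇒SingleOccurrence S x occ≡1 with occurrences S x in eq | occ≡1
... | t ∷ [] | _ = record
  { suffix = t ; occurrences≡ = eq ; suffix∈tails = proj₁ t∈ ; prefix = proj₂ t∈ }
  where
  t∈ = ∈-filter⁻ (λ t → take (length x) t ≟s x) (subst (t ∈_) (sym eq) (here refl))

-- For a word occurring exactly once this is the starting position of its occurrence.
position : Str σ → Str σ → ℕ
position S x = length S ∸ sum (map length (occurrences S x))

module _ {S x : Str σ} (o : SingleOccurrence S x) where
  open SingleOccurrence o

  position≡ : position S x ≡ length S ∸ length suffix
  position≡ = trans (cong (λ ts → length S ∸ sum (map length ts)) occurrences≡)
                    (cong (length S ∸_) (+-identityʳ (length suffix)))

  length≤length-suffix : length x ≤ length suffix
  length≤length-suffix = take-length⇒length≤ prefix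

Triple : ℕ → Set
Triple σ = Str σ × Fin σ × Fin σ

IsCounted : Str σ → Triple σ → Set
IsCounted S (w , p) = 2 ≤ occ S w × InΦ S w p

isCounted? : (S : Str σ) (e : Triple σ) → Dec (IsCounted S e)
isCounted? S (w , p) with 2 ≤? occ S w | InΦ? S w p
... | yes r  | yes φ = yes (r , φ)
... | no ¬r  | _     = no (¬r ∘ proj₁)
... | yes _  | no ¬φ = no (¬φ ∘ proj₂)

extension : Triple σ → Str σ
extension (w , α , β) = α ∷ w ++ [ β ]

pairs : (σ : ℕ) → List (Fin σ × Fin σ)
pairs σ = cartesianProduct (allFin σ) (allFin σ)

countedTriples : Str σ → List (Triple σ)
countedTriples {σ} S = filter (isCounted? S) (cartesianProduct (substrings S) (pairs σ))

module _ (S w : Str σ) where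

  length-filter-InΦ≤ : 2 ≤ occ S w → (ps : List (Fin σ × Fin σ)) →
                       length (filter (InΦ? S w) ps) ≤ length (filter (isCounted? S) (map (w ,_) ps))
  length-filter-InΦ≤ r [] = z≤n
  length-filter-InΦ≤ r (p ∷ ps) with InΦ? S w p | isCounted? S (w , p)
  ... | yes _ | yes _ = s≤s (length-filter-InΦ≤ r ps)
  ... | yes φ | no ¬c = contradiction (r , φ) ¬c
  ... | no _  | yes _ = m≤n⇒m≤1+n (length-filter-InΦ≤ r ps)
  ... | no _  | no _  = length-filter-InΦ≤ r ps

  φ≤length-counted : φ S w ≤ length (filter (isCounted? S) (map (w ,_) (pairs σ)))
  φ≤length-counted with 2 ≤? occ S w
  ... | yes r = length-filter-InΦ≤ r (pairs σ)
  ... | no _  = z≤n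

sum-φ≤length-counted : (S : Str σ) (ws : List (Str σ)) →
                       sum (map (φ S) ws) ≤ length (filter (isCounted? S) (cartesianProduct ws (pairs σ)))
sum-φ≤length-counted S [] = z≤n
sum-φ≤length-counted {σ} S (w ∷ ws) =
  ≤-trans (+-mono-≤ (φ≤length-counted S w) (sum-φ≤length-counted S ws))
          (≤-reflexive (sym (trans (cong length (filter-++ (isCounted? S) (map (w ,_) (pairs σ)) _))
                                   (length-++ (filter (isCounted? S) (map (w ,_) (pairs σ)))))))

countedTriples-unique : (S : Str σ) → Unique (countedTriples S)
countedTriples-unique {σ} S =
  Unique.filter⁺ (isCounted? S)
    (Unique.cartesianProduct⁺ (DecUnique.deduplicate-! _≟s_ (concatMap inits (tails S)))
                              (Unique.cartesianProduct⁺ (Unique.allFin⁺ σ) (Unique.allFin⁺ σ)))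

2≤length-extension : (e : Triple σ) → 2 ≤ length (extension e)
2≤length-extension (w , α , β) = s≤s (subst (1 ≤_) (sym (length-++ w)) (m≤n+m 1 (length w)))

position-extension< : {S : Str σ} {e : Triple σ} → IsCounted S e → position S (extension e) < length S ∸ 1
position-extension< {S = S} {e@(_ , _ , _)} (_ , occ≡1 , _) =
  subst (_< length S ∸ 1) (sym (position≡ o))
        (∸-monoʳ-< (≤-trans (2≤length-extension e) (length≤length-suffix o)) (∈-tails⇒length≤ suffix∈tails))
  where
  o = occ≡1⇒SingleOccurrence S (extension e) occ≡1
  open SingleOccurrence o

repeat-no-longer-than-unique-extension :
  (S w w′ d d′ : Str σ) {β β′ : Fin σ} → (w ++ [ β ]) ++ d ≡ (w′ ++ [ β′ ]) ++ d′ →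
  occ S (w ++ [ β ]) ≡ 1 → 2 ≤ occ S w′ → length w′ ≤ length w
repeat-no-longer-than-unique-extension S w w′ d d′ {β} {β′} eq occ≡1 repeat = ≮⇒≥ w≮w′
  where
  w≮w′ : ¬ length w < length w′
  w≮w′ w<w′ with ++-≡-++⇒prefix (w ++ [ β ]) d w′ ([ β′ ] ++ d′) (trans eq (++-assoc w′ [ β′ ] d′))
                                 (subst (_≤ length w′) (sym (trans (length-++ w) (+-comm (length w) 1))) w<w′)
  ... | q , refl = contradiction (begin
        2                              ≤⟨ repeat ⟩
        occ S ((w ++ [ β ]) ++ q)      ≤⟨ occ-++-≤ S (w ++ [ β ]) q ⟩
        occ S (w ++ [ β ])             ≡⟨ occ≡1 ⟩
        1                              ∎) λ { (s≤s ()) }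
    where open ≤-Reasoning

counted-sharing-occurrence⇒≡ : {S t : Str σ} {e e′ : Triple σ} → IsCounted S e → IsCounted S e′ →
                               take (length (extension e)) t ≡ extension e →
                               take (length (extension e′)) t ≡ extension e′ → e ≡ e′
counted-sharing-occurrence⇒≡ {S = S} {e = w , _ , β} {w′ , _ , β′}
                             (repeat , _ , _ , occ≡1) (repeat′ , _ , _ , occ′≡1) pre pre′
  with ∷-injective (trans (sym (take-length⇒++-drop pre)) (take-length⇒++-drop pre′))
... | refl , eq with ∷ʳ-injective w w′ (++-≡-++⇒≡ (w ++ [ β ]) _ (w′ ++ [ β′ ]) _ eq length≡)
  where
  length≡ : length (w ++ [ β ]) ≡ length (w′ ++ [ β′ ])
  length≡ = trans (length-++ w)
           (trans (cong (_+ 1) (≤-antisym (repeat-no-longer-than-unique-extension S w′ w _ _ (sym eq) occ′≡1 repeat)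
                                          (repeat-no-longer-than-unique-extension S w w′ _ _ eq occ≡1 repeat′)))
                  (sym (length-++ w′)))
...   | refl , refl = refl

position-extension-injective : {S : Str σ} {e e′ : Triple σ} → IsCounted S e → IsCounted S e′ →
                               position S (extension e) ≡ position S (extension e′) → e ≡ e′
position-extension-injective {S = S} {e@(_ , _ , _)} {e′@(_ , _ , _)} c@(_ , occ≡1 , _) c′@(_ , occ′≡1 , _) eq =
  counted-sharing-occurrence⇒≡ c c′ (prefix o)
    (subst (λ t → take (length (extension e′)) t ≡ extension e′) (sym suffix≡) (prefix o′))
  where
  open SingleOccurrence
  o  = occ≡1⇒SingleOccurrence S (extension e) occ≡1
  o′ = occ≡1⇒SingleOccurrence S (extension e′) occ′≡1
  suffix≡ : suffix o ≡ suffix o′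
  suffix≡ = ∈-tails-length-injective (suffix∈tails o) (suffix∈tails o′)
              (∸-cancelˡ-≡ (∈-tails⇒length≤ (suffix∈tails o)) (∈-tails⇒length≤ (suffix∈tails o′))
                           (trans (sym (position≡ o)) (trans eq (position≡ o′))))

n∸1≤2*n∸2 : ∀ n → n ∸ 1 ≤ 2 * n ∸ 2
n∸1≤2*n∸2 n = ≤-trans (m≤m+n (n ∸ 1) _) (≤-reflexive (*-distribˡ-∸ 2 n 1))

lemma4 : (σ : ℕ) (S : Str σ) → totalNetFreq S ≤ 2 * length S ∸ 2
lemma4 σ S = begin
  totalNetFreq S                      ≤⟨ sum-φ≤length-counted S (substrings S) ⟩
  length (countedTriples S)           ≡⟨ length-map key (countedTriples S) ⟨
  length (map key (countedTriples S)) ≤⟨ Unique∧All<⇒length≤ (length S ∸ 1) keys-unique keys-bounded ⟩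
  length S ∸ 1                        ≤⟨ n∸1≤2*n∸2 (length S) ⟩
  2 * length S ∸ 2                    ∎
  where
  open ≤-Reasoning
  key : Triple σ → ℕ
  key = position S ∘ extension
  isCounted : ∀ {e} → e ∈ countedTriples S → IsCounted S e
  isCounted = proj₂ ∘ ∈-filter⁻ (isCounted? S) {xs = cartesianProduct (substrings S) (pairs σ)}
  keys-unique : Unique (map key (countedTriples S))
  keys-unique = map⁺-injectiveOn key (λ e∈ e′∈ → position-extension-injective (isCounted e∈) (isCounted e′∈))
                                 (countedTriples-unique S)
  keys-bounded : All (_< length S ∸ 1) (map key (countedTriples S))
  keys-bounded = All.map⁺ (All.tabulate (position-extension< {S = S} ∘ isCounted))
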